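{- Let $M=(E,r)$ be a $q$-matroid and let $F\le E$ be a flat of $M$. Then $\mathrm{cyc}(F)$ is a cyclic flat of $M$.
   Context: Let $q$ be a prime power and $E$ an $n$-dimensional $\mathbb{F}_q$-vector space. A $q$-matroid $(E,r)$ is a function $r$ from subspaces of $E$ to $\mathbb{Z}$ with (R1) $0\le r(A)\le\dim A$, (R2) $r(A)\le r(B)$ if $A\le B$, (R3) $r(A+B)+r(A\cap B)\le r(A)+r(B)$. $\mathrm{cyc}(A)=\sum x$ over all $1$-dimensional $x\le A$ with $r(B+x)=r(B)$ for every subspace $B\le A$ of codimension $1$ in $A$. A flat is a subspace $F$ with $r(F+x)>r(F)$ for all $1$-dimensional $x\not\le F$; a subspace $A$ is cyclic if $r(B)=r(A)$ for every $B\le A$ of codimension $1$ in $A$; a cyclic flat is a subspace that is both cyclic and a flat. -}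

module Defs where

open import Level using (Level; 0ℓ) renaming (suc to lsuc)
open import Data.Nat using (ℕ; zero; suc; _+_; _^_; _≤_; _<_)
open import Data.Unit using (⊤; tt)
open import Data.Sum using (_⊎_)
open import Data.Nat.Primality using (Prime)
open import Data.Fin using (Fin)
open import Data.Vec using (Vec; []; _∷_; replicate; zipWith; map; _++_)
open import Data.Vec.Relation.Unary.All using (All)
import Data.Vec.Relation.Unary.All as All
import Data.Vec.Relation.Unary.All.Properties as AllP
open import Data.Product using (Σ; ∃; ∃-syntax; _×_; _,_)
open import Relation.Binary.PropositionalEquality using (_≡_; refl; sym; trans; cong; cong₂; module ≡-Reasoning)
open import Relation.Nullary using (¬_)
open import Function.Bundles using (_↔_)

IsPrimePower : ℕ → Set
IsPrimePower q = ∃[ p ] ∃[ k ] (Prime p × q ≡ p ^ suc k)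

record Field : Set₁ where
  field
    Carrier : Set
    _⊕_ _⊗_ : Carrier → Carrier → Carrier
    𝟘 𝟙 : Carrier
    ⊖_ : Carrier → Carrier
    ⊕-assoc : ∀ a b c → (a ⊕ b) ⊕ c ≡ a ⊕ (b ⊕ c)
    ⊕-comm : ∀ a b → a ⊕ b ≡ b ⊕ a
    ⊕-identityˡ : ∀ a → 𝟘 ⊕ a ≡ a
    ⊕-inverseˡ : ∀ a → (⊖ a) ⊕ a ≡ 𝟘
    ⊗-assoc : ∀ a b c → (a ⊗ b) ⊗ c ≡ a ⊗ (b ⊗ c)
    ⊗-comm : ∀ a b → a ⊗ b ≡ b ⊗ a
    ⊗-identityˡ : ∀ a → 𝟙 ⊗ a ≡ a
    distribˡ : ∀ a b c → a ⊗ (b ⊕ c) ≡ (a ⊗ b) ⊕ (a ⊗ c)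
    𝟘≢𝟙 : ¬ (𝟘 ≡ 𝟙)
    ⊗-inverse : ∀ a → ¬ (a ≡ 𝟘) → ∃[ b ] (b ⊗ a ≡ 𝟙)

-- Linear algebra in E = F^n, n-dimensional F-vector space

module LinAlg (F : Field) (n : ℕ) where
  open Field F

  V : Set
  V = Vec Carrier n

  0v : V
  0v = replicate n 𝟘

  _+v_ : V → V → V
  _+v_ = zipWith _⊕_

  _·_ : Carrier → V → V
  c · v = map (c ⊗_) v

  lincomb : ∀ {d} → Vec Carrier d → Vec V d → V
  lincomb [] [] = 0v
  lincomb (c ∷ cs) (u ∷ us) = (c · u) +v lincomb cs us

  record Subspace : Set₁ where
    field
      _∋_ : V → Set
      ∋-0 : _∋_ 0v
      ∋-+ : ∀ {u v} → _∋_ u → _∋_ v → _∋_ (u +v v)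
      ∋-· : ∀ c {v} → _∋_ v → _∋_ (c · v)
  open Subspace public

  _∈_ : V → Subspace → Set
  v ∈ A = A ∋ v

  _≤S_ : Subspace → Subspace → Set
  A ≤S B = ∀ v → v ∈ A → v ∈ B

  _≈S_ : Subspace → Subspace → Set
  A ≈S B = A ≤S B × B ≤S A

  ⊗-zeroʳ : ∀ c → c ⊗ 𝟘 ≡ 𝟘
  ⊗-zeroʳ c = begin
      c ⊗ 𝟘                      ≡⟨ sym (⊕-identityˡ _) ⟩
      𝟘 ⊕ (c ⊗ 𝟘)                ≡⟨ cong (_⊕ (c ⊗ 𝟘)) (sym (⊕-inverseˡ x)) ⟩
      ((⊖ x) ⊕ x) ⊕ x            ≡⟨ ⊕-assoc _ _ _ ⟩
      (⊖ x) ⊕ (x ⊕ x)            ≡⟨ cong ((⊖ x) ⊕_) (sym (distribˡ c 𝟘 𝟘)) ⟩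
      (⊖ x) ⊕ (c ⊗ (𝟘 ⊕ 𝟘))      ≡⟨ cong (λ t → (⊖ x) ⊕ (c ⊗ t)) (⊕-identityˡ 𝟘) ⟩
      (⊖ x) ⊕ x                  ≡⟨ ⊕-inverseˡ x ⟩
      𝟘 ∎
    where open ≡-Reasoning
          x = c ⊗ 𝟘

  +v-assoc : ∀ {m} (a b c : Vec Carrier m) → zipWith _⊕_ (zipWith _⊕_ a b) c ≡ zipWith _⊕_ a (zipWith _⊕_ b c)
  +v-assoc [] [] [] = refl
  +v-assoc (x ∷ a) (y ∷ b) (z ∷ c) = cong₂ _∷_ (⊕-assoc x y z) (+v-assoc a b c)

  +v-identityˡ : ∀ {m} (a : Vec Carrier m) → zipWith _⊕_ (replicate m 𝟘) a ≡ a
  +v-identityˡ [] = refl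
  +v-identityˡ (x ∷ a) = cong₂ _∷_ (⊕-identityˡ x) (+v-identityˡ a)

  ·-distrib : ∀ {m} c (a b : Vec Carrier m) → map (c ⊗_) (zipWith _⊕_ a b) ≡ zipWith _⊕_ (map (c ⊗_) a) (map (c ⊗_) b)
  ·-distrib c [] [] = refl
  ·-distrib c (x ∷ a) (y ∷ b) = cong₂ _∷_ (distribˡ c x y) (·-distrib c a b)

  ·-zero : ∀ {m} c → map (c ⊗_) (replicate m 𝟘) ≡ replicate m 𝟘
  ·-zero {zero} c = refl
  ·-zero {suc m} c = cong₂ _∷_ (⊗-zeroʳ c) (·-zero {m} c)

  ·-assoc : ∀ {m} c d (a : Vec Carrier m) → map (c ⊗_) (map (d ⊗_) a) ≡ map ((c ⊗ d) ⊗_) a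
  ·-assoc c d [] = refl
  ·-assoc c d (x ∷ a) = cong₂ _∷_ (sym (⊗-assoc c d x)) (·-assoc c d a)

  lincomb-++ : ∀ {d e} (cs : Vec Carrier d) (us : Vec V d) (ds : Vec Carrier e) (vs : Vec V e) →
               lincomb (cs ++ ds) (us ++ vs) ≡ lincomb cs us +v lincomb ds vs
  lincomb-++ [] [] ds vs = sym (+v-identityˡ _)
  lincomb-++ (c ∷ cs) (u ∷ us) ds vs =
    trans (cong ((c · u) +v_) (lincomb-++ cs us ds vs))
          (sym (+v-assoc (c · u) (lincomb cs us) (lincomb ds vs)))

  lincomb-· : ∀ {d} c (cs : Vec Carrier d) (us : Vec V d) →
              c · lincomb cs us ≡ lincomb (map (c ⊗_) cs) us
  lincomb-· c [] [] = ·-zero c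
  lincomb-· c (d ∷ cs) (u ∷ us) =
    trans (·-distrib c (d · u) (lincomb cs us))
          (cong₂ _+v_ (·-assoc c d u) (lincomb-· c cs us))

  InSpan : ∀ {ℓ} → (V → Set ℓ) → V → Set ℓ
  InSpan S v = ∃[ d ] Σ (Vec Carrier d) λ cs → Σ (Vec V d) λ us →
                 All S us × v ≡ lincomb cs us

  Span : (V → Set) → Subspace
  Span S = record
    { _∋_ = InSpan S
    ; ∋-0 = 0 , [] , [] , All.[] , refl
    ; ∋-+ = λ { (d , cs , us , su , refl) (e , ds , vs , sv , refl) →
                 d + e , cs ++ ds , us ++ vs , AllP.++⁺ su sv , sym (lincomb-++ cs us ds vs) }
    ; ∋-· = λ { c (d , cs , us , su , refl) → d , map (c ⊗_) cs , us , su , lincomb-· c cs us } }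

  _⊞_ : Subspace → Subspace → Subspace
  A ⊞ B = Span (λ v → v ∈ A ⊎ v ∈ B)

  _⊓_ : Subspace → Subspace → Subspace
  A ⊓ B = record
    { _∋_ = λ v → v ∈ A × v ∈ B
    ; ∋-0 = ∋-0 A , ∋-0 B
    ; ∋-+ = λ (a₁ , b₁) (a₂ , b₂) → ∋-+ A a₁ a₂ , ∋-+ B b₁ b₂
    ; ∋-· = λ c (a , b) → ∋-· A c a , ∋-· B c b }

  LinIndep : ∀ {d} → Vec V d → Set
  LinIndep {d} us = ∀ (cs : Vec Carrier d) → lincomb cs us ≡ 0v → cs ≡ replicate d 𝟘

  HasDim : Subspace → ℕ → Set
  HasDim A d = Σ (Vec V d) λ us →
                 All (_∈ A) us × LinIndep us × (∀ v → v ∈ A → ∃[ cs ] (v ≡ lincomb {d} cs us))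

  Codim1In : Subspace → Subspace → Set
  Codim1In B A = B ≤S A × ∃[ d ] (HasDim B d × HasDim A (suc d))

  ⊤S : Subspace
  ⊤S = record { _∋_ = λ _ → ⊤ ; ∋-0 = tt ; ∋-+ = λ _ _ → tt ; ∋-· = λ _ _ → tt }

module _ (F : Field) (n : ℕ) where
  open LinAlg F n

  record IsQMatroid (r : Subspace → ℕ) : Set₁ where
    field
      -- r is a function of the subspace (not of its presentation)
      r-cong : ∀ {A B} → A ≈S B → r A ≡ r B
      -- (R1)  0 ≤ r(A) ≤ dim A   (0 ≤ r(A) is automatic as r is ℕ-valued)
      R1 : ∀ A d → HasDim A d → r A ≤ d
      R2 : ∀ A B → A ≤S B → r A ≤ r B
      R3 : ∀ A B → r (A ⊞ B) + r (A ⊓ B) ≤ r A + r B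

module QMat (F : Field) (n : ℕ) (r : LinAlg.Subspace F n → ℕ) where
  open LinAlg F n

  CycAtom : Subspace → Subspace → Set₁
  CycAtom A x = HasDim x 1 × x ≤S A × (∀ B → Codim1In B A → r (B ⊞ x) ≡ r B)

  -- cyc(A) is not a level-0 predicate (its defining condition quantifies over
  -- all subspaces), so we state "C is (the subspace) cyc(A)" as a relation:
  -- C has exactly the vectors of the sum of all the CycAtom's x of A,
  -- i.e. of the span of their union.
  CycVec : Subspace → V → Set₁
  CycVec A v = ∃[ x ] (CycAtom A x × v ∈ x)

  IsCycOf : Subspace → Subspace → Set₁
  IsCycOf A C = ∀ v → (v ∈ C → InSpan (CycVec A) v) × (InSpan (CycVec A) v → v ∈ C)

  IsFlat : Subspace → Set₁
  IsFlat F' = ∀ x → HasDim x 1 → ¬ (x ≤S F') → r F' < r (F' ⊞ x)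

  IsCyclic : Subspace → Set₁
  IsCyclic A = ∀ B → Codim1In B A → r B ≡ r A

  IsCyclicFlat : Subspace → Set₁
  IsCyclicFlat A = IsCyclic A × IsFlat A

{-# OPTIONS --safe #-}
-- Let C = cyc(F).  A vector v ∈ F outside C spans a line that is not a cyclic atom of F, so some
-- hyperplane H of F has r(H + v) > r H; then r H < r F, and since every cyclic atom y satisfies
-- r(H + y) = r H, no atom can avoid H: C ≤ H.  Intersecting with such hyperplanes walks down from
-- F to C losing one dimension and at least one unit of rank per step, which gives the key
-- inequality  dim F − dim C ≤ r F − r C.
-- Cyclic: if B is a hyperplane of C, some cyclic atom y is not contained in B; a hyperplane H of
-- F through B avoiding y has r F = r(H + y) = r H ≤ r B + (dim H − dim B), and the key inequality
-- turns this into r C ≤ r B.  Flat: for u ∈ F ∖ C, the rank of F exceeds that of C + ⟨u⟩ by at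
-- most the codimension, so the key inequality forces r(C + ⟨u⟩) > r C; for u ∉ F, submodularity
-- passes the rank jump of the flat F down to C ≤ F.
-- The space is finite, so membership in a subspace is decidable up to double negation; this
-- suffices because every conclusion is a decidable statement about natural numbers.
module Submission where

open import Defs
open import Level using (Level; 0ℓ)
open import Algebra.Bundles using (AbelianGroup)
open import Algebra.Structures using (IsAbelianGroup)
open import Algebra.Consequences.Propositional
  using (comm∧distrˡ⇒distrʳ; comm∧assoc⇒middleFour)
import Algebra.Properties.AbelianGroup as AbelianGroupProperties
open import Data.Nat using (ℕ; zero; suc; _+_; _^_; _≤_; _<_; z≤n; s≤s)
import Data.Nat.Properties as ℕP
open import Data.Fin using (Fin; combine; remQuot)
import Data.Fin as Fin
import Data.Fin.Properties as FinP
open import Data.Vec using (Vec; []; _∷_; replicate; zipWith; map; _++_)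
import Data.Vec.Properties as VecP
open import Data.Vec.Relation.Unary.All using (All; []; _∷_)
import Data.Vec.Relation.Unary.All as All
import Data.Vec.Relation.Unary.All.Properties as AllP
open import Data.Product using (Σ; ∃; ∃₂; ∃-syntax; _×_; _,_; proj₁; proj₂)
open import Data.Sum using (_⊎_; inj₁; inj₂)
open import Function.Base using (_∘_; case_of_)
open import Function.Bundles using (_↔_; Inverse)
open import Relation.Binary.PropositionalEquality
  using (_≡_; refl; sym; trans; cong; cong₂; subst; isEquivalence; module ≡-Reasoning)
open import Relation.Binary.Definitions using (DecidableEquality)
open import Relation.Nullary using (¬_; Dec; yes; no; ¬?; _×-dec_)
open import Relation.Nullary.Decidable using (map′; decidable-stable; ¬¬-excluded-middle)
open import Relation.Nullary.Negation using (DoubleNegation; negated-stable; ¬¬-map; contradiction)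
open import Relation.Unary using (Decidable)

private variable
  a b : Level
  A : Set a
  B : Set b

_>>=_ : DoubleNegation A → (A → DoubleNegation B) → DoubleNegation B
x >>= f = negated-stable (¬¬-map f x)

return : A → DoubleNegation A
return = contradiction

module FiniteVectorSpace
  (𝔽 : Field) {q : ℕ} (enumeration : Fin q ↔ Field.Carrier 𝔽) (n : ℕ) where
  open Field 𝔽
  open LinAlg 𝔽 n
  open Inverse enumeration using (to; from; strictlyInverseˡ; strictlyInverseʳ)

  private variable
    d k m : ℕ

  -𝟙 : Carrier
  -𝟙 = ⊖ 𝟙

  ⊗-zeroˡ : ∀ x → 𝟘 ⊗ x ≡ 𝟘
  ⊗-zeroˡ x = trans (⊗-comm 𝟘 x) (⊗-zeroʳ x)

  ⊗-distribʳ : ∀ x y z → (y ⊕ z) ⊗ x ≡ (y ⊗ x) ⊕ (z ⊗ x)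
  ⊗-distribʳ = comm∧distrˡ⇒distrʳ ⊗-comm distribˡ

  x⊕-𝟙x≡𝟘 : ∀ x → x ⊕ (-𝟙 ⊗ x) ≡ 𝟘
  x⊕-𝟙x≡𝟘 x = begin
    x ⊕ (-𝟙 ⊗ x)        ≡⟨ cong (_⊕ (-𝟙 ⊗ x)) (sym (⊗-identityˡ x)) ⟩
    (𝟙 ⊗ x) ⊕ (-𝟙 ⊗ x)  ≡⟨ sym (⊗-distribʳ x 𝟙 -𝟙) ⟩
    (𝟙 ⊕ -𝟙) ⊗ x        ≡⟨ cong (_⊗ x) (trans (⊕-comm 𝟙 -𝟙) (⊕-inverseˡ 𝟙)) ⟩
    𝟘 ⊗ x               ≡⟨ ⊗-zeroˡ x ⟩
    𝟘                   ∎
    where open ≡-Reasoning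

  infixl 6 _+ᵛ_
  infixr 7 _*ᵛ_
  infix  8 -ᵛ_

  _+ᵛ_ : Vec Carrier m → Vec Carrier m → Vec Carrier m
  _+ᵛ_ = zipWith _⊕_

  _*ᵛ_ : Carrier → Vec Carrier m → Vec Carrier m
  c *ᵛ v = map (c ⊗_) v

  -ᵛ_ : Vec Carrier m → Vec Carrier m
  -ᵛ v = -𝟙 *ᵛ v

  𝟎 : Vec Carrier m
  𝟎 = replicate _ 𝟘

  +ᵛ-comm : ∀ (u v : Vec Carrier m) → u +ᵛ v ≡ v +ᵛ u
  +ᵛ-comm []      []      = refl
  +ᵛ-comm (x ∷ u) (y ∷ v) = cong₂ _∷_ (⊕-comm x y) (+ᵛ-comm u v)

  +ᵛ-identityʳ : ∀ (u : Vec Carrier m) → u +ᵛ 𝟎 ≡ u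
  +ᵛ-identityʳ u = trans (+ᵛ-comm u 𝟎) (+v-identityˡ u)

  +ᵛ-inverseʳ : ∀ (u : Vec Carrier m) → u +ᵛ -ᵛ u ≡ 𝟎
  +ᵛ-inverseʳ []      = refl
  +ᵛ-inverseʳ (x ∷ u) = cong₂ _∷_ (x⊕-𝟙x≡𝟘 x) (+ᵛ-inverseʳ u)

  +ᵛ-isAbelianGroup : IsAbelianGroup _≡_ (_+ᵛ_ {m}) 𝟎 -ᵛ_
  +ᵛ-isAbelianGroup = record
    { isGroup = record
      { isMonoid = record
        { isSemigroup = record
          { isMagma = record { isEquivalence = isEquivalence ; ∙-cong = cong₂ _+ᵛ_ }
          ; assoc   = +v-assoc }
        ; identity = +v-identityˡ , +ᵛ-identityʳ }
      ; inverse = (λ u → trans (+ᵛ-comm (-ᵛ u) u) (+ᵛ-inverseʳ u)) , +ᵛ-inverseʳ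
      ; ⁻¹-cong = cong -ᵛ_ }
    ; comm = +ᵛ-comm }

  +ᵛ-abelianGroup : ℕ → AbelianGroup 0ℓ 0ℓ
  +ᵛ-abelianGroup m = record { isAbelianGroup = +ᵛ-isAbelianGroup {m} }

  open module +ᵛ-Properties {m} = AbelianGroupProperties (+ᵛ-abelianGroup m)
    using (inverseˡ-unique; x≈y⇒x∙y⁻¹≈ε; x∙y⁻¹≈ε⇒x≈y; xyx⁻¹≈y)

  *ᵛ-identityˡ : ∀ (u : Vec Carrier m) → 𝟙 *ᵛ u ≡ u
  *ᵛ-identityˡ []      = refl
  *ᵛ-identityˡ (x ∷ u) = cong₂ _∷_ (⊗-identityˡ x) (*ᵛ-identityˡ u)

  *ᵛ-zeroˡ : ∀ (u : Vec Carrier m) → 𝟘 *ᵛ u ≡ 𝟎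
  *ᵛ-zeroˡ []      = refl
  *ᵛ-zeroˡ (x ∷ u) = cong₂ _∷_ (⊗-zeroˡ x) (*ᵛ-zeroˡ u)

  *ᵛ-distribʳ : ∀ c d (u : Vec Carrier m) → (c ⊕ d) *ᵛ u ≡ c *ᵛ u +ᵛ d *ᵛ u
  *ᵛ-distribʳ c d []      = refl
  *ᵛ-distribʳ c d (x ∷ u) = cong₂ _∷_ (⊗-distribʳ x c d) (*ᵛ-distribʳ c d u)

  lincomb-𝟎 : ∀ (us : Vec V d) → lincomb 𝟎 us ≡ 0v
  lincomb-𝟎 []       = refl
  lincomb-𝟎 (u ∷ us) = trans (cong₂ _+ᵛ_ (*ᵛ-zeroˡ u) (lincomb-𝟎 us)) (+v-identityˡ 0v)

  lincomb-𝟘∷ : ∀ u (cs : Vec Carrier d) us → lincomb (𝟘 ∷ cs) (u ∷ us) ≡ lincomb cs us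
  lincomb-𝟘∷ u cs us = trans (cong (_+ᵛ lincomb cs us) (*ᵛ-zeroˡ u)) (+v-identityˡ _)

  lincomb-+ : ∀ (cs ds : Vec Carrier d) us →
              lincomb (cs +ᵛ ds) us ≡ lincomb cs us +ᵛ lincomb ds us
  lincomb-+ []       []       []       = sym (+v-identityˡ 0v)
  lincomb-+ (c ∷ cs) (d ∷ ds) (u ∷ us) =
    trans (cong₂ _+ᵛ_ (*ᵛ-distribʳ c d u) (lincomb-+ cs ds us))
          (comm∧assoc⇒middleFour +ᵛ-comm +v-assoc (c *ᵛ u) (d *ᵛ u) _ _)

  lincomb-− : ∀ (cs ds : Vec Carrier d) us →
              lincomb (cs +ᵛ -ᵛ ds) us ≡ lincomb cs us +ᵛ -ᵛ lincomb ds us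
  lincomb-− cs ds us =
    trans (lincomb-+ cs (-ᵛ ds) us) (cong (lincomb cs us +ᵛ_) (sym (lincomb-· -𝟙 ds us)))

  lincomb-injective : {us : Vec V d} → LinIndep us →
                      ∀ {cs ds} → lincomb cs us ≡ lincomb ds us → cs ≡ ds
  lincomb-injective {us = us} indep {cs} {ds} eq =
    x∙y⁻¹≈ε⇒x≈y cs ds (indep _ (trans (lincomb-− cs ds us) (x≈y⇒x∙y⁻¹≈ε eq)))

  -- Finite-field coordinates

  from-injective : ∀ {x y} → from x ≡ from y → x ≡ y
  from-injective {x} {y} eq =
    trans (sym (strictlyInverseˡ x)) (trans (cong to eq) (strictlyInverseˡ y))

  _≟_ : DecidableEquality Carrier
  x ≟ y = map′ from-injective (cong from) (from x Fin.≟ from y)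

  _≟ᵛ_ : DecidableEquality (Vec Carrier m)
  _≟ᵛ_ = VecP.≡-dec _≟_

  encode : Vec Carrier m → Fin (q ^ m)
  encode []      = Fin.zero
  encode (c ∷ v) = combine (from c) (encode v)

  decode : ∀ m → Fin (q ^ m) → Vec Carrier m
  decode zero    _ = []
  decode (suc m) i = let (j , i′) = remQuot {q} (q ^ m) i in to j ∷ decode m i′

  decode∘encode : ∀ (v : Vec Carrier m) → decode m (encode v) ≡ v
  decode∘encode []              = refl
  decode∘encode {suc m} (c ∷ v) =
    cong₂ _∷_ (trans (cong (to ∘ proj₁) split) (strictlyInverseˡ c))
              (trans (cong (decode m ∘ proj₂) split) (decode∘encode v))
    where split = FinP.remQuot-combine {q} {q ^ m} (from c) (encode v)

  encode∘decode : ∀ m (i : Fin (q ^ m)) → encode (decode m i) ≡ i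
  encode∘decode zero    Fin.zero = refl
  encode∘decode (suc m) i =
    trans (cong₂ combine (strictlyInverseʳ _) (encode∘decode m (proj₂ (remQuot {q} (q ^ m) i))))
          (FinP.combine-remQuot {q} (q ^ m) i)

  any?ᵛ : ∀ {P : Vec Carrier m → Set} → Decidable P → Dec (∃ P)
  any?ᵛ {m} {P} P? = map′ (λ (i , p) → decode m i , p)
                          (λ (v , p) → encode v , subst P (sym (decode∘encode v)) p)
                          (FinP.any? (P? ∘ decode m))

  ¬¬-∀Fin : ∀ k {P : Fin k → Set} →
            (∀ i → DoubleNegation (P i)) → DoubleNegation (∀ i → P i)
  ¬¬-∀Fin zero    _ ¬∀ = ¬∀ λ ()
  ¬¬-∀Fin (suc k) h ¬∀ = h Fin.zero λ p₀ →
    ¬¬-∀Fin k (h ∘ Fin.suc) λ ps → ¬∀ λ { Fin.zero → p₀ ; (Fin.suc i) → ps i }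

  ¬¬-∀ᵛ : ∀ {P : Vec Carrier m → Set} →
          (∀ v → DoubleNegation (P v)) → DoubleNegation (∀ v → P v)
  ¬¬-∀ᵛ {m} {P} h =
    ¬¬-map (λ ∀P v → subst P (decode∘encode v) (∀P (encode v))) (¬¬-∀Fin _ (h ∘ decode m))

  ¬¬-decidable : ∀ A → DoubleNegation (Decidable (_∈ A))
  ¬¬-decidable A = ¬¬-∀ᵛ λ _ → ¬¬-excluded-middle

  2≤q : 2 ≤ q
  2≤q = FinP.injective⇒≤ {f = from ∘ 𝟘-or-𝟙} injective
    where
      𝟘-or-𝟙 : Fin 2 → Carrier
      𝟘-or-𝟙 Fin.zero    = 𝟘
      𝟘-or-𝟙 (Fin.suc _) = 𝟙

      injective : ∀ {i j} → from (𝟘-or-𝟙 i) ≡ from (𝟘-or-𝟙 j) → i ≡ j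
      injective {Fin.zero}         {Fin.zero}         _  = refl
      injective {Fin.suc Fin.zero} {Fin.suc Fin.zero} _  = refl
      injective {Fin.zero}         {Fin.suc Fin.zero} eq = contradiction (from-injective eq) 𝟘≢𝟙
      injective {Fin.suc Fin.zero} {Fin.zero}         eq =
        contradiction (from-injective (sym eq)) 𝟘≢𝟙

  injective⇒≤ : (f : Vec Carrier m → Vec Carrier k) → (∀ {u v} → f u ≡ f v → u ≡ v) →
                m ≤ k
  injective⇒≤ {m} {k} f f-injective =
    ℕP.≮⇒≥ λ k<m → ℕP.<⇒≱ (ℕP.^-monoʳ-< q 2≤q k<m) q^m≤q^k
    where
      q^m≤q^k : q ^ m ≤ q ^ k
      q^m≤q^k = FinP.injective⇒≤ {f = encode ∘ f ∘ decode m} λ {i} {j} eq → begin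
        i                    ≡⟨ encode∘decode m i ⟨
        encode (decode m i)  ≡⟨ cong encode (f-injective (begin
          f (decode m i)                      ≡⟨ decode∘encode _ ⟨
          decode k (encode (f (decode m i)))  ≡⟨ cong (decode k) eq ⟩
          decode k (encode (f (decode m j)))  ≡⟨ decode∘encode _ ⟩
          f (decode m j)                      ∎)) ⟩
        encode (decode m j)  ≡⟨ encode∘decode m j ⟩
        j                    ∎
        where open ≡-Reasoning

  -- Spans of finite families

  _∉_ : V → Subspace → Set
  v ∉ A = ¬ v ∈ A

  ⟨_⟩ : Vec V d → Subspace
  ⟨ us ⟩ = record
    { _∋_ = λ v → ∃[ cs ] v ≡ lincomb cs us
    ; ∋-0 = 𝟎 , sym (lincomb-𝟎 us)
    ; ∋-+ = λ { (cs , refl) (ds , refl) → cs +ᵛ ds , sym (lincomb-+ cs ds us) }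
    ; ∋-· = λ { c (cs , refl) → c *ᵛ cs , lincomb-· c cs us } }

  ∈⟨⟩? : (us : Vec V d) → Decidable (_∈ ⟨ us ⟩)
  ∈⟨⟩? us v = any?ᵛ λ cs → v ≟ᵛ lincomb cs us

  lincomb-∈ : ∀ A {us : Vec V d} → All (_∈ A) us → ∀ cs → lincomb cs us ∈ A
  lincomb-∈ A []           []       = ∋-0 A
  lincomb-∈ A (u∈A ∷ us∈A) (c ∷ cs) = ∋-+ A (∋-· A c u∈A) (lincomb-∈ A us∈A cs)

  ⟨⟩-least : ∀ {A} {us : Vec V d} → All (_∈ A) us → ⟨ us ⟩ ≤S A
  ⟨⟩-least {A = A} us∈A _ (cs , refl) = lincomb-∈ A us∈A cs

  u∈⟨u∷us⟩ : ∀ u (us : Vec V d) → u ∈ ⟨ u ∷ us ⟩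
  u∈⟨u∷us⟩ u us =
    𝟙 ∷ 𝟎 , sym (trans (cong₂ _+ᵛ_ (*ᵛ-identityˡ u) (lincomb-𝟎 us)) (+ᵛ-identityʳ u))

  ⟨us⟩≤⟨u∷us⟩ : ∀ u (us : Vec V d) → ⟨ us ⟩ ≤S ⟨ u ∷ us ⟩
  ⟨us⟩≤⟨u∷us⟩ u us _ (cs , refl) = 𝟘 ∷ cs , sym (lincomb-𝟘∷ u cs us)

  ∈⟨⟩-all : ∀ (us : Vec V d) → All (_∈ ⟨ us ⟩) us
  ∈⟨⟩-all []       = []
  ∈⟨⟩-all (u ∷ us) = u∈⟨u∷us⟩ u us ∷ All.map (⟨us⟩≤⟨u∷us⟩ u us _) (∈⟨⟩-all us)

  ∈-+ᵛ-cancelˡ : ∀ A {u w} → u ∈ A → (u +ᵛ w) ∈ A → w ∈ A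
  ∈-+ᵛ-cancelˡ A {u} {w} u∈A u+w∈A =
    subst (_∈ A) (xyx⁻¹≈y u w) (∋-+ A u+w∈A (∋-· A -𝟙 u∈A))

  ∈-InSpan : ∀ {ℓ} {S : V → Set ℓ} {v} → S v → InSpan S v
  ∈-InSpan {v = v} s =
    1 , 𝟙 ∷ [] , v ∷ [] , s ∷ [] , sym (trans (cong (_+ᵛ 0v) (*ᵛ-identityˡ v)) (+ᵛ-identityʳ v))

  A≤A⊞B : ∀ A B → A ≤S (A ⊞ B)
  A≤A⊞B A B _ v∈A = ∈-InSpan (inj₁ v∈A)

  B≤A⊞B : ∀ A B → B ≤S (A ⊞ B)
  B≤A⊞B A B _ v∈B = ∈-InSpan (inj₂ v∈B)

  ⊞-least : ∀ {A B X} → A ≤S X → B ≤S X → (A ⊞ B) ≤S X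
  ⊞-least {A} {B} {X} A≤X B≤X _ (_ , cs , us , us∈A∪B , refl) =
    lincomb-∈ X (All.map A∪B≤X us∈A∪B) cs
    where
      A∪B≤X : ∀ {v} → v ∈ A ⊎ v ∈ B → v ∈ X
      A∪B≤X (inj₁ v∈A) = A≤X _ v∈A
      A∪B≤X (inj₂ v∈B) = B≤X _ v∈B

  lincomb-∈-or-∉ : ∀ {ℓ} {S : V → Set ℓ} H → Decidable (_∈ H) → {us : Vec V d} →
                   All S us → ∀ cs → lincomb cs us ∈ H ⊎ Σ V λ u → S u × u ∉ H
  lincomb-∈-or-∉ H H? []       []       = inj₁ (∋-0 H)
  lincomb-∈-or-∉ H H? {u ∷ us} (s ∷ ss) (c ∷ cs) with H? u | lincomb-∈-or-∉ H H? ss cs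
  ... | no u∉H  | _            = inj₂ (u , s , u∉H)
  ... | yes _   | inj₂ outside = inj₂ outside
  ... | yes u∈H | inj₁ rest∈H  = inj₁ (∋-+ H (∋-· H c u∈H) rest∈H)

  ⊈⇒∃∉ : ∀ {A B} → Decidable (_∈ B) → ¬ A ≤S B →
         DoubleNegation (Σ V λ v → v ∈ A × v ∉ B)
  ⊈⇒∃∉ B? A≰B ∄ = A≰B λ v v∈A → decidable-stable (B? v) λ v∉B → ∄ (v , v∈A , v∉B)

  -- Independence and dimension

  LinIndep-[] : LinIndep []
  LinIndep-[] [] _ = refl

  LinIndep-∷ : ∀ {u} {us : Vec V d} → LinIndep us → u ∉ ⟨ us ⟩ → LinIndep (u ∷ us)
  LinIndep-∷ {u = u} {us} indep u∉⟨us⟩ (c ∷ cs) eq with c ≟ 𝟘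
  ... | yes refl = cong (𝟘 ∷_) (indep cs (trans (sym (lincomb-𝟘∷ u cs us)) eq))
  ... | no c≢𝟘 with ⊗-inverse c c≢𝟘
  ...   | c⁻¹ , c⁻¹c≡𝟙 = contradiction (c⁻¹ *ᵛ -ᵛ cs , u≡) u∉⟨us⟩
    where
      open ≡-Reasoning
      u≡ : u ≡ lincomb (c⁻¹ *ᵛ -ᵛ cs) us
      u≡ = begin
        u                             ≡⟨ *ᵛ-identityˡ u ⟨
        𝟙 *ᵛ u                        ≡⟨ cong (_*ᵛ u) c⁻¹c≡𝟙 ⟨
        (c⁻¹ ⊗ c) *ᵛ u                ≡⟨ ·-assoc c⁻¹ c u ⟨
        c⁻¹ *ᵛ c *ᵛ u                 ≡⟨ cong (c⁻¹ *ᵛ_) (inverseˡ-unique (c *ᵛ u) _ eq) ⟩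
        c⁻¹ *ᵛ -ᵛ lincomb cs us       ≡⟨ cong (c⁻¹ *ᵛ_) (lincomb-· -𝟙 cs us) ⟩
        c⁻¹ *ᵛ lincomb (-ᵛ cs) us     ≡⟨ lincomb-· c⁻¹ (-ᵛ cs) us ⟩
        lincomb (c⁻¹ *ᵛ -ᵛ cs) us     ∎

  insert-𝟘 : ∀ k {m} → Vec Carrier (k + m) → Vec Carrier (k + suc m)
  insert-𝟘 zero    cs       = 𝟘 ∷ cs
  insert-𝟘 (suc k) (c ∷ cs) = c ∷ insert-𝟘 k cs

  lincomb-insert-𝟘 : ∀ (ws : Vec V k) {u} {us : Vec V m} cs →
                     lincomb (insert-𝟘 k cs) (ws ++ u ∷ us) ≡ lincomb cs (ws ++ us)
  lincomb-insert-𝟘 []       {u} cs       = lincomb-𝟘∷ u cs _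
  lincomb-insert-𝟘 (w ∷ ws)     (c ∷ cs) = cong (c *ᵛ w +ᵛ_) (lincomb-insert-𝟘 ws cs)

  insert-𝟘≡𝟎 : ∀ k {m} (cs : Vec Carrier (k + m)) → insert-𝟘 k cs ≡ 𝟎 → cs ≡ 𝟎
  insert-𝟘≡𝟎 zero    cs       eq = VecP.∷-injectiveʳ eq
  insert-𝟘≡𝟎 (suc k) (c ∷ cs) eq =
    cong₂ _∷_ (VecP.∷-injectiveˡ eq) (insert-𝟘≡𝟎 k cs (VecP.∷-injectiveʳ eq))

  LinIndep-drop : ∀ (ws : Vec V k) {u} {us : Vec V m} →
                  LinIndep (ws ++ u ∷ us) → LinIndep (ws ++ us)
  LinIndep-drop ws indep cs eq = insert-𝟘≡𝟎 _ cs (indep _ (trans (lincomb-insert-𝟘 ws cs) eq))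

  LinIndep⇒length≤ : {us : Vec V d} {vs : Vec V m} → LinIndep us → All (_∈ ⟨ vs ⟩) us → d ≤ m
  LinIndep⇒length≤ {us = us} {vs} indep us∈⟨vs⟩ = injective⇒≤ coordinates λ {cs} {ds} eq →
    lincomb-injective indep (begin
      lincomb cs us                 ≡⟨ coordinates-correct cs ⟩
      lincomb (coordinates cs) vs   ≡⟨ cong (λ es → lincomb es vs) eq ⟩
      lincomb (coordinates ds) vs   ≡⟨ coordinates-correct ds ⟨
      lincomb ds us                 ∎)
    where
      open ≡-Reasoning

      coordinates : Vec Carrier _ → Vec Carrier _
      coordinates cs = proj₁ (lincomb-∈ ⟨ vs ⟩ us∈⟨vs⟩ cs)

      coordinates-correct : ∀ cs → lincomb cs us ≡ lincomb (coordinates cs) vs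
      coordinates-correct cs = proj₂ (lincomb-∈ ⟨ vs ⟩ us∈⟨vs⟩ cs)

  LinIndep⇒length≤n : {us : Vec V d} → LinIndep us → d ≤ n
  LinIndep⇒length≤n {us = us} indep =
    injective⇒≤ (λ cs → lincomb cs us) (lincomb-injective indep)

  LinIndep⇒length≤dim : ∀ {A e} {us : Vec V d} →
                        HasDim A e → LinIndep us → All (_∈ A) us → d ≤ e
  LinIndep⇒length≤dim (_ , _ , _ , A≤⟨bs⟩) indep us∈A =
    LinIndep⇒length≤ indep (All.map (A≤⟨bs⟩ _) us∈A)

  dim-mono : ∀ {A B e} → A ≤S B → HasDim A d → HasDim B e → d ≤ e
  dim-mono {B = B} A≤B (_ , as∈A , indep , _) dimB =
    LinIndep⇒length≤dim {A = B} dimB indep (All.map (A≤B _) as∈A)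

  codim1-proper : ∀ {A B} → Codim1In B A → ¬ A ≤S B
  codim1-proper {A} {B} (_ , _ , dimB , (as , as∈A , indep , _)) A≤B =
    ℕP.<-irrefl refl (LinIndep⇒length≤dim {A = B} dimB indep (All.map (A≤B _) as∈A))

  LinIndep-length≡dim⇒spans : ∀ {A} {us : Vec V d} →
                              HasDim A d → LinIndep us → All (_∈ A) us → A ≤S ⟨ us ⟩
  LinIndep-length≡dim⇒spans {A = A} {us} dimA indep us∈A v v∈A =
    decidable-stable (∈⟨⟩? us v) λ v∉⟨us⟩ →
      ℕP.<-irrefl refl
        (LinIndep⇒length≤dim {A = A} dimA (LinIndep-∷ indep v∉⟨us⟩) (v∈A ∷ us∈A))

  ⟨⟩-hasDim : {us : Vec V d} → LinIndep us → HasDim ⟨ us ⟩ d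
  ⟨⟩-hasDim {us = us} indep = us , ∈⟨⟩-all us , indep , λ _ v∈⟨us⟩ → v∈⟨us⟩

  IsBasis : Subspace → Vec V d → Set
  IsBasis A us = All (_∈ A) us × LinIndep us × A ≤S ⟨ us ⟩

  extend-basis : ∀ {A} → Decidable (_∈ A) → {us : Vec V m} → All (_∈ A) us → LinIndep us →
                 ∃₂ λ k (ws : Vec V k) → IsBasis A (ws ++ us)
  extend-basis {m} {A} A? {us} us∈A indep = grow n [] us∈A indep (ℕP.m≤n+m n m)
    where
      spans-or-∉ : (vs : Vec V k) → A ≤S ⟨ vs ⟩ ⊎ Σ V λ v → v ∈ A × v ∉ ⟨ vs ⟩
      spans-or-∉ vs with any?ᵛ (λ v → A? v ×-dec ¬? (∈⟨⟩? vs v))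
      ... | yes outside = inj₂ outside
      ... | no ∄ =
        inj₁ λ v v∈A → decidable-stable (∈⟨⟩? vs v) λ v∉⟨vs⟩ → ∄ (v , v∈A , v∉⟨vs⟩)

      grow : ∀ fuel (ws : Vec V k) → All (_∈ A) (ws ++ us) → LinIndep (ws ++ us) →
             n ≤ k + m + fuel → ∃₂ λ k (ws : Vec V k) → IsBasis A (ws ++ us)
      grow fuel ws ws++us∈A indep′ room with spans-or-∉ (ws ++ us)
      ... | inj₁ spans = _ , ws , ws++us∈A , indep′ , spans
      grow {k} zero ws _ indep′ room | inj₂ (_ , _ , v∉) =
        contradiction (LinIndep⇒length≤n (LinIndep-∷ indep′ v∉))
                      (ℕP.<⇒≱ (s≤s (subst (n ≤_) (ℕP.+-identityʳ (k + m)) room)))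
      grow {k} (suc fuel) ws ws++us∈A indep′ room | inj₂ (v , v∈A , v∉) =
        grow fuel (v ∷ ws) (v∈A ∷ ws++us∈A) (LinIndep-∷ indep′ v∉)
             (subst (n ≤_) (ℕP.+-suc (k + m) fuel) room)

  hasDim : ∀ {A} → Decidable (_∈ A) → ∃ (HasDim A)
  hasDim {A} A? with extend-basis {A = A} A? [] LinIndep-[]
  ... | k , ws , basis = k + 0 , ws ++ [] , basis

  -- Hyperplanes

  hyperplane-≤⟨∷⟩ : ∀ {H F u} → Codim1In H F → u ∈ F → u ∉ H →
                    ∃₂ λ e (hs : Vec V e) → All (_∈ H) hs × F ≤S ⟨ u ∷ hs ⟩
  hyperplane-≤⟨∷⟩ {H} {F} {u} (H≤F , e , (hs , hs∈H , hs-indep , _) , dimF) u∈F u∉H =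
    e , hs , hs∈H ,
    LinIndep-length≡dim⇒spans {A = F} dimF u∷hs-indep (u∈F ∷ All.map (H≤F _) hs∈H)
    where
      u∷hs-indep : LinIndep (u ∷ hs)
      u∷hs-indep = LinIndep-∷ hs-indep (u∉H ∘ ⟨⟩-least {A = H} hs∈H u)

  hyperplane-≤⊞ : ∀ {H F u} Y → Codim1In H F → u ∈ F → u ∉ H → u ∈ Y → F ≤S (H ⊞ Y)
  hyperplane-≤⊞ {H} {F} Y hyper u∈F u∉H u∈Y v v∈F
    with hyperplane-≤⟨∷⟩ {H} {F} hyper u∈F u∉H
  ... | _ , hs , hs∈H , F≤⟨u∷hs⟩ =
    ⟨⟩-least {A = H ⊞ Y} (B≤A⊞B H Y _ u∈Y ∷ All.map (A≤A⊞B H Y _) hs∈H) v (F≤⟨u∷hs⟩ v v∈F)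

  ⊓-hyperplane-dim : ∀ {H F X v m} → Codim1In H F → X ≤S F → v ∈ X → v ∉ H →
                     HasDim X d → HasDim (X ⊓ H) m → d ≡ suc m
  ⊓-hyperplane-dim {H = H} {F} {X} {v} hyper X≤F v∈X v∉H dimX
                   (bs , bs∈X⊓H , bs-indep , X⊓H≤⟨bs⟩) =
    ℕP.≤-antisym (dim-mono {A = X} {B = ⟨ v ∷ bs ⟩} X≤⟨v∷bs⟩ dimX (⟨⟩-hasDim v∷bs-indep))
                 (LinIndep⇒length≤dim {A = X} dimX v∷bs-indep (v∈X ∷ All.map proj₁ bs∈X⊓H))
    where
      v∷bs-indep : LinIndep (v ∷ bs)
      v∷bs-indep = LinIndep-∷ bs-indep λ v∈⟨bs⟩ →
        v∉H (proj₂ (⟨⟩-least {A = X ⊓ H} bs∈X⊓H v v∈⟨bs⟩))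

      X≤⟨v∷bs⟩ : X ≤S ⟨ v ∷ bs ⟩
      X≤⟨v∷bs⟩ w w∈X with hyperplane-≤⟨∷⟩ {H} {F} hyper (X≤F v v∈X) v∉H
      ... | _ , hs , hs∈H , F≤⟨v∷hs⟩ with F≤⟨v∷hs⟩ w (X≤F w w∈X)
      ...   | c ∷ cs , w≡cv+h
              with X⊓H≤⟨bs⟩ _ ( ∈-+ᵛ-cancelˡ X (∋-· X c v∈X) (subst (_∈ X) w≡cv+h w∈X)
                              , lincomb-∈ H hs∈H cs )
      ...     | ds , h≡ = c ∷ ds , trans w≡cv+h (cong (c *ᵛ v +ᵛ_) h≡)

  hyperplane-through : ∀ {B F u} → Decidable (_∈ F) → HasDim B d → B ≤S F → u ∈ F → u ∉ B →
                       Σ Subspace λ H → Codim1In H F × B ≤S H × F ≤S (H ⊞ ⟨ u ∷ [] ⟩)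
  hyperplane-through {d} {B} {F} {u} F? (bs , bs∈B , bs-indep , B≤⟨bs⟩) B≤F u∈F u∉B
    with extend-basis {A = F} F? (u∈F ∷ All.map (B≤F _) bs∈B)
                      (LinIndep-∷ bs-indep (u∉B ∘ ⟨⟩-least {A = B} bs∈B u))
  ... | k , ws , ws++u∷bs∈F , indep , F≤⟨ws++u∷bs⟩ =
    H , (H≤F , k + d , dimH , dimF) , B≤H , F≤H⊞u
    where
      H = ⟨ ws ++ bs ⟩
      ⟨u⟩ = ⟨ u ∷ [] ⟩
      ws∈H = proj₁ (AllP.++⁻ ws (∈⟨⟩-all (ws ++ bs)))
      bs∈H = proj₂ (AllP.++⁻ ws (∈⟨⟩-all (ws ++ bs)))

      H≤F : H ≤S F
      H≤F = let (ws∈F , u∷bs∈F) = AllP.++⁻ ws ws++u∷bs∈F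
            in ⟨⟩-least {A = F} (AllP.++⁺ ws∈F (All.tail u∷bs∈F))

      dimH : HasDim H (k + d)
      dimH = ⟨⟩-hasDim (LinIndep-drop ws indep)

      dimF : HasDim F (suc (k + d))
      dimF = subst (HasDim F) (ℕP.+-suc k d) (ws ++ u ∷ bs , ws++u∷bs∈F , indep , F≤⟨ws++u∷bs⟩)

      B≤H : B ≤S H
      B≤H v v∈B = ⟨⟩-least {A = H} bs∈H v (B≤⟨bs⟩ v v∈B)

      F≤H⊞u : F ≤S (H ⊞ ⟨ u ∷ [] ⟩)
      F≤H⊞u v v∈F = ⟨⟩-least {A = H ⊞ ⟨u⟩} ws++u∷bs∈H⊞u v (F≤⟨ws++u∷bs⟩ v v∈F)
        where
          ws++u∷bs∈H⊞u =
            AllP.++⁺ (All.map (A≤A⊞B H ⟨u⟩ _) ws∈H)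
                     (B≤A⊞B H ⟨u⟩ u (u∈⟨u∷us⟩ u []) ∷ All.map (A≤A⊞B H ⟨u⟩ _) bs∈H)

module QMatroidRank
  (𝔽 : Field) {q : ℕ} (enumeration : Fin q ↔ Field.Carrier 𝔽) (n : ℕ)
  (r : LinAlg.Subspace 𝔽 n → ℕ) (isQ : IsQMatroid 𝔽 n r) where
  open LinAlg 𝔽 n
  open FiniteVectorSpace 𝔽 enumeration n
  open IsQMatroid isQ
  open ℕP.≤-Reasoning

  private variable
    d k m : ℕ

  r-⊞ : ∀ A B → r (A ⊞ B) ≤ r A + r B
  r-⊞ A B = ℕP.≤-trans (ℕP.m≤m+n _ _) (R3 A B)

  r-⟨⟩ : (us : Vec V d) → r ⟨ us ⟩ ≤ d
  r-⟨⟩ us with hasDim {⟨ us ⟩} (∈⟨⟩? us)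
  ... | e , dim@(_ , bs∈⟨us⟩ , indep , _) =
    ℕP.≤-trans (R1 ⟨ us ⟩ e dim) (LinIndep⇒length≤ indep bs∈⟨us⟩)

  r-⟨++⟩ : (ws : Vec V k) (us : Vec V m) → r ⟨ ws ++ us ⟩ ≤ r ⟨ us ⟩ + k
  r-⟨++⟩ {k} ws us = begin
    r ⟨ ws ++ us ⟩        ≤⟨ R2 _ _ (⟨⟩-least {A = ⟨ us ⟩ ⊞ ⟨ ws ⟩} ws++us∈⊞) ⟩
    r (⟨ us ⟩ ⊞ ⟨ ws ⟩)   ≤⟨ r-⊞ ⟨ us ⟩ ⟨ ws ⟩ ⟩
    r ⟨ us ⟩ + r ⟨ ws ⟩   ≤⟨ ℕP.+-monoʳ-≤ (r ⟨ us ⟩) (r-⟨⟩ ws) ⟩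
    r ⟨ us ⟩ + k          ∎
    where
      ws++us∈⊞ = AllP.++⁺ (All.map (B≤A⊞B ⟨ us ⟩ ⟨ ws ⟩ _) (∈⟨⟩-all ws))
                          (All.map (A≤A⊞B ⟨ us ⟩ ⟨ ws ⟩ _) (∈⟨⟩-all us))

  r-codim : ∀ {A X a x} → Decidable (_∈ X) → A ≤S X → HasDim A a → HasDim X x →
            r X + a ≤ r A + x
  r-codim {A} {X} {a} {x} X? A≤X (as , as∈A , indep , _) dimX
    with extend-basis {A = X} X? (All.map (A≤X _) as∈A) indep
  ... | k , ws , ws++as∈X , indep′ , X≤⟨ws++as⟩ = begin
    r X + a             ≤⟨ ℕP.+-monoˡ-≤ a (R2 _ _ X≤⟨ws++as⟩) ⟩
    r ⟨ ws ++ as ⟩ + a  ≤⟨ ℕP.+-monoˡ-≤ a (r-⟨++⟩ ws as) ⟩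
    r ⟨ as ⟩ + k + a    ≤⟨ ℕP.+-monoˡ-≤ a (ℕP.+-monoˡ-≤ k (R2 _ _ ⟨as⟩≤A)) ⟩
    r A + k + a         ≡⟨ ℕP.+-assoc (r A) k a ⟩
    r A + (k + a)       ≤⟨ ℕP.+-monoʳ-≤ (r A) k+a≤x ⟩
    r A + x             ∎
    where
      ⟨as⟩≤A = ⟨⟩-least {A = A} as∈A
      k+a≤x = LinIndep⇒length≤dim {A = X} dimX indep′ ws++as∈X

  <-transfer : ∀ {p p′ s t} → p < p′ → p′ + s ≤ t + p → s < t
  <-transfer {p} {p′} {s} {t} p<p′ ineq = ℕP.+-cancelʳ-≤ p (suc s) t (begin
    suc s + p   ≡⟨ ℕP.+-comm (suc s) p ⟩
    p + suc s   ≡⟨ ℕP.+-suc p s ⟩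
    suc p + s   ≤⟨ ℕP.+-monoˡ-≤ s p<p′ ⟩
    p′ + s      ≤⟨ ineq ⟩
    t + p       ∎)

  r-⊓-< : ∀ {H X v} → r H < r (H ⊞ ⟨ v ∷ [] ⟩) → v ∈ X → r (X ⊓ H) < r X
  r-⊓-< {H} {X} {v} jump v∈X = <-transfer (ℕP.<-≤-trans jump (R2 _ _ H⊞v≤X⊞H)) (R3 X H)
    where
      H⊞v≤X⊞H : (H ⊞ ⟨ v ∷ [] ⟩) ≤S (X ⊞ H)
      H⊞v≤X⊞H = ⊞-least {H} {⟨ v ∷ [] ⟩} {X ⊞ H} (B≤A⊞B X H)
                         (⟨⟩-least {A = X ⊞ H} (A≤A⊞B X H v v∈X ∷ []))

  r-jump-antitone : ∀ {A B} Y → A ≤S B → r B < r (B ⊞ Y) → r A < r (A ⊞ Y)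
  r-jump-antitone {A} {B} Y A≤B jump =
    ℕP.≤-<-trans (R2 _ _ A≤[A⊞Y]⊓B)
                 (<-transfer (ℕP.<-≤-trans jump (R2 _ _ B⊞Y≤[A⊞Y]⊞B)) (R3 (A ⊞ Y) B))
    where
      A≤[A⊞Y]⊓B : A ≤S ((A ⊞ Y) ⊓ B)
      A≤[A⊞Y]⊓B v v∈A = A≤A⊞B A Y v v∈A , A≤B v v∈A

      B⊞Y≤[A⊞Y]⊞B : (B ⊞ Y) ≤S ((A ⊞ Y) ⊞ B)
      B⊞Y≤[A⊞Y]⊞B = ⊞-least {B} {Y} {(A ⊞ Y) ⊞ B} (B≤A⊞B (A ⊞ Y) B)
                             λ v v∈Y → A≤A⊞B (A ⊞ Y) B v (B≤A⊞B A Y v v∈Y)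

  jump⇒∉ : ∀ {H v} → r H < r (H ⊞ ⟨ v ∷ [] ⟩) → v ∉ H
  jump⇒∉ {H} {v} jump v∈H =
    ℕP.<⇒≱ jump (R2 _ _ (⊞-least {H} {⟨ v ∷ [] ⟩} {H} (λ _ w∈H → w∈H)
                                   (⟨⟩-least {A = H} (v∈H ∷ []))))

module CycOf
  (𝔽 : Field) {q : ℕ} (enumeration : Fin q ↔ Field.Carrier 𝔽) (n : ℕ)
  (r : LinAlg.Subspace 𝔽 n → ℕ) (isQ : IsQMatroid 𝔽 n r)
  (F C : LinAlg.Subspace 𝔽 n) (C-is-cyc : QMat.IsCycOf 𝔽 n r F C) where
  open LinAlg 𝔽 n
  open FiniteVectorSpace 𝔽 enumeration n
  open QMatroidRank 𝔽 enumeration n r isQ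
  open QMat 𝔽 n r
  open IsQMatroid isQ
  open ℕP.≤-Reasoning

  cyc≤F : C ≤S F
  cyc≤F v v∈C with proj₁ (C-is-cyc v) v∈C
  ... | _ , cs , us , us-cyc , refl =
    lincomb-∈ F (All.map (λ (x , (_ , x≤F , _) , u∈x) → x≤F _ u∈x) us-cyc) cs

  atom≤cyc : ∀ {x} → CycAtom F x → x ≤S C
  atom≤cyc {x} atom v v∈x = proj₂ (C-is-cyc v) (∈-InSpan (x , atom , v∈x))

  cyc-generator-∉ : ∀ {B c} → Decidable (_∈ B) → c ∈ C → c ∉ B →
                    Σ V λ u → CycVec F u × u ∉ B
  cyc-generator-∉ {B} B? c∈C c∉B with proj₁ (C-is-cyc _) c∈C
  ... | _ , cs , us , us-cyc , refl with lincomb-∈-or-∉ B B? us-cyc cs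
  ...   | inj₁ c∈B     = contradiction c∈B c∉B
  ...   | inj₂ outside = outside

  cyc≤hyperplane : ∀ {H} → Decidable (_∈ H) → Codim1In H F → r H < r F → C ≤S H
  cyc≤hyperplane {H} H? hyper rH<rF w w∈C = decidable-stable (H? w) λ w∉H →
    let (u , (x , (_ , x≤F , x-no-jump) , u∈x) , u∉H) = cyc-generator-∉ {H} H? w∈C w∉H
    in ℕP.<⇒≱ rH<rF (begin
      r F        ≤⟨ R2 _ _ (hyperplane-≤⊞ {H} {F} x hyper (x≤F u u∈x) u∉H u∈x) ⟩
      r (H ⊞ x)  ≡⟨ x-no-jump H hyper ⟩
      r H        ∎)

  hyperplane-with-jump : ∀ {v} → v ∈ F → v ∉ C →
                         DoubleNegation (Σ Subspace λ H →
                                           Codim1In H F × r H < r (H ⊞ ⟨ v ∷ [] ⟩))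
  hyperplane-with-jump {v} v∈F v∉C ∄H =
    v∉C (atom≤cyc {⟨ v ∷ [] ⟩} atom v (u∈⟨u∷us⟩ v []))
    where
      v∉⟨⟩ : v ∉ ⟨ [] ⟩
      v∉⟨⟩ ([] , v≡0) = v∉C (subst (_∈ C) (sym v≡0) (∋-0 C))

      atom : CycAtom F ⟨ v ∷ [] ⟩
      atom = ⟨⟩-hasDim (LinIndep-∷ LinIndep-[] v∉⟨⟩) , ⟨⟩-least {A = F} (v∈F ∷ []) ,
             λ B hyper → decidable-stable (r (B ⊞ ⟨ v ∷ [] ⟩) ℕP.≟ r B) λ r≢ →
               ∄H (B , hyper , ℕP.≤∧≢⇒< (R2 _ _ (A≤A⊞B B ⟨ v ∷ [] ⟩)) (r≢ ∘ sym))

  record Shrinking (X : Subspace) (x : ℕ) : Set₁ where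
    field
      X′        : Subspace
      x′        : ℕ
      dimX′     : HasDim X′ x′
      cyc≤X′    : C ≤S X′
      X′≤F      : X′ ≤S F
      r-shrinks : r X′ < r X
      x≡1+x′    : x ≡ suc x′

  shrink : ∀ {X x v} → HasDim X x → C ≤S X → X ≤S F → v ∈ X → v ∉ C →
           DoubleNegation (Shrinking X x)
  shrink {X} {x} {v} dimX C≤X X≤F v∈X v∉C = do
    (H , hyper , jump) ← hyperplane-with-jump (X≤F v v∈X) v∉C
    H? ← ¬¬-decidable H
    X? ← ¬¬-decidable X
    let (x′ , dimX′) = hasDim {X ⊓ H} λ w → X? w ×-dec H? w
        rH<rF = ℕP.<-≤-trans jump (R2 _ _ (⊞-least {H} {⟨ v ∷ [] ⟩} {F} (proj₁ hyper)
                                                     (⟨⟩-least {A = F} (X≤F v v∈X ∷ []))))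
    return record
      { X′        = X ⊓ H
      ; x′        = x′
      ; dimX′     = dimX′
      ; cyc≤X′    = λ w w∈C → C≤X w w∈C , cyc≤hyperplane H? hyper rH<rF w w∈C
      ; X′≤F      = λ w → X≤F w ∘ proj₁
      ; r-shrinks = r-⊓-< jump v∈X
      ; x≡1+x′    = ⊓-hyperplane-dim {H = H} {F = F} {X = X} hyper X≤F v∈X (jump⇒∉ jump)
                                     dimX dimX′
      }

  rank-gap : ∀ fuel {X c x} → HasDim C c → HasDim X x → x ≤ fuel → C ≤S X → X ≤S F →
             DoubleNegation (r C + x ≤ r X + c)
  rank-gap zero dimC dimX x≤0 C≤X X≤F =
    return (ℕP.+-mono-≤ (R2 _ _ C≤X) (ℕP.≤-trans x≤0 z≤n))
  rank-gap (suc fuel) {X} {c} {x} dimC dimX x≤1+fuel C≤X X≤F = do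
    C? ← ¬¬-decidable C
    no X≰C ← ¬¬-excluded-middle
      where yes X≤C → return (ℕP.+-mono-≤ (ℕP.≤-reflexive (r-cong (C≤X , X≤C)))
                                          (dim-mono {A = X} {B = C} X≤C dimX dimC))
    (v , v∈X , v∉C) ← ⊈⇒∃∉ {X} {C} C? X≰C
    s ← shrink dimX C≤X X≤F v∈X v∉C
    let open Shrinking s
    gap ← rank-gap fuel dimC dimX′ (ℕP.≤-pred (subst (_≤ suc fuel) x≡1+x′ x≤1+fuel))
                   cyc≤X′ X′≤F
    return (subst (λ x → r C + x ≤ r X + c) (sym x≡1+x′) (begin
      r C + suc x′    ≡⟨ ℕP.+-suc (r C) x′ ⟩
      suc (r C + x′)  ≤⟨ s≤s gap ⟩
      suc (r X′) + c  ≤⟨ ℕP.+-monoˡ-≤ c r-shrinks ⟩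
      r X + c         ∎))

  cyc-rank-gap : ∀ {c f} → HasDim C c → HasDim F f → r C + f ≤ r F + c
  cyc-rank-gap {c} {f} dimC dimF =
    decidable-stable (r C + f ℕP.≤? r F + c)
                     (rank-gap f dimC dimF ℕP.≤-refl cyc≤F (λ _ v∈F → v∈F))

  r-cyc≤r-hyperplane : ∀ {B d y u} → Decidable (_∈ F) →
                       B ≤S C → HasDim B d → HasDim C (suc d) →
                       CycAtom F y → u ∈ y → u ∉ B → DoubleNegation (r C ≤ r B)
  r-cyc≤r-hyperplane {B} {d} {y} {u} F? B≤C dimB dimC (_ , y≤F , y-no-jump) u∈y u∉B = do
    let (H , hyper@(_ , e , dimH , dimF) , B≤H , F≤H⊞u) =
          hyperplane-through {B = B} {F = F} F? dimB (λ w → cyc≤F w ∘ B≤C w) (y≤F u u∈y) u∉B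
    H? ← ¬¬-decidable H
    let H⊞u≤H⊞y = ⊞-least {H} {⟨ u ∷ [] ⟩} {H ⊞ y} (A≤A⊞B H y)
                           (⟨⟩-least {A = H ⊞ y} (B≤A⊞B H y u u∈y ∷ []))
        rF≤rH : r F ≤ r H
        rF≤rH = begin
          r F        ≤⟨ R2 _ _ (λ w → H⊞u≤H⊞y w ∘ F≤H⊞u w) ⟩
          r (H ⊞ y)  ≡⟨ y-no-jump H hyper ⟩
          r H        ∎
    return (ℕP.+-cancelʳ-≤ (suc e) (r C) (r B) (begin
      r C + suc e    ≤⟨ cyc-rank-gap dimC dimF ⟩
      r F + suc d    ≡⟨ ℕP.+-suc (r F) d ⟩
      suc (r F + d)  ≤⟨ s≤s (ℕP.≤-trans (ℕP.+-monoˡ-≤ d rF≤rH) (r-codim H? B≤H dimB dimH)) ⟩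
      suc (r B + e)  ≡⟨ ℕP.+-suc (r B) e ⟨
      r B + suc e    ∎))

  cyc-cyclic : IsCyclic C
  cyc-cyclic B B-hyper@(B≤C , d , dimB , dimC) =
    ℕP.≤-antisym (R2 B C B≤C) (decidable-stable (r C ℕP.≤? r B) do
      B? ← ¬¬-decidable B
      F? ← ¬¬-decidable F
      (c , c∈C , c∉B) ← ⊈⇒∃∉ {C} {B} B? (codim1-proper {C} {B} B-hyper)
      let (u , (y , y-atom , u∈y) , u∉B) = cyc-generator-∉ {B} B? c∈C c∉B
      r-cyc≤r-hyperplane {B = B} {y = y} F? B≤C dimB dimC y-atom u∈y u∉B)

  cyc-jump : ∀ {u} → u ∈ F → u ∉ C → DoubleNegation (r C < r (C ⊞ ⟨ u ∷ [] ⟩))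
  cyc-jump {u} u∈F u∉C = do
    C? ← ¬¬-decidable C
    F? ← ¬¬-decidable F
    let (c , dimC@(cs , cs∈C , cs-indep , _)) = hasDim {C} C?
        (f , dimF) = hasDim {F} F?
        u∷cs-indep = LinIndep-∷ cs-indep (u∉C ∘ ⟨⟩-least {A = C} cs∈C u)
        ⟨u∷cs⟩≤F = ⟨⟩-least {A = F} (u∈F ∷ All.map (cyc≤F _) cs∈C)
        ⟨u∷cs⟩≤C⊞u = ⟨⟩-least {A = C ⊞ ⟨ u ∷ [] ⟩}
          (B≤A⊞B C ⟨ u ∷ [] ⟩ u (u∈⟨u∷us⟩ u []) ∷ All.map (A≤A⊞B C ⟨ u ∷ [] ⟩ _) cs∈C)
    return (ℕP.+-cancelʳ-≤ f (suc (r C)) (r (C ⊞ ⟨ u ∷ [] ⟩)) (begin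
      suc (r C + f)              ≤⟨ s≤s (cyc-rank-gap dimC dimF) ⟩
      suc (r F + c)              ≡⟨ ℕP.+-suc (r F) c ⟨
      r F + suc c                ≤⟨ r-codim F? ⟨u∷cs⟩≤F (⟨⟩-hasDim u∷cs-indep) dimF ⟩
      r ⟨ u ∷ cs ⟩ + f           ≤⟨ ℕP.+-monoˡ-≤ f (R2 _ _ ⟨u∷cs⟩≤C⊞u) ⟩
      r (C ⊞ ⟨ u ∷ [] ⟩) + f     ∎))

  cyc-flat : IsFlat F → IsFlat C
  cyc-flat F-flat x dimx@(u ∷ [] , u∈x ∷ [] , _ , x≤⟨u⟩) x≰C =
    decidable-stable (suc (r C) ℕP.≤? r (C ⊞ x)) do
      F? ← ¬¬-decidable F
      case F? u of λ where
        (no u∉F)  → return (r-jump-antitone x cyc≤F (F-flat x dimx λ x≤F → u∉F (x≤F u u∈x)))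
        (yes u∈F) → ¬¬-map (λ jump → ℕP.<-≤-trans jump (R2 _ _ C⊞u≤C⊞x))
                           (cyc-jump u∈F u∉C)
    where
      u∉C : u ∉ C
      u∉C u∈C = x≰C λ v v∈x → ⟨⟩-least {A = C} (u∈C ∷ []) v (x≤⟨u⟩ v v∈x)
      C⊞u≤C⊞x : (C ⊞ ⟨ u ∷ [] ⟩) ≤S (C ⊞ x)
      C⊞u≤C⊞x = ⊞-least {C} {⟨ u ∷ [] ⟩} {C ⊞ x} (A≤A⊞B C x)
                         (⟨⟩-least {A = C ⊞ x} (B≤A⊞B C x u u∈x ∷ []))

lemma2p21 : (q : ℕ) → IsPrimePower q → (𝔽 : Field) → (Fin q ↔ Field.Carrier 𝔽) →
    (n : ℕ) (r : LinAlg.Subspace 𝔽 n → ℕ) → IsQMatroid 𝔽 n r →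
    (F C : LinAlg.Subspace 𝔽 n) → QMat.IsFlat 𝔽 n r F → QMat.IsCycOf 𝔽 n r F C →
    QMat.IsCyclicFlat 𝔽 n r C
lemma2p21 q _ 𝔽 enumeration n r isQ F C F-flat C-is-cyc = cyc-cyclic , cyc-flat F-flat
  where open CycOf 𝔽 enumeration n r isQ F C C-is-cyc
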